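{- Let $G$ be a graph of order $n\geq 9$ with minimum degree $\delta(G)\geq n-4$ and maximum degree $\Delta(G)\geq n-3$. Then $G$ contains $S_n(3)$ and $S_n(2,1)$.
   Context: All graphs are finite, simple, undirected; "contains" means contains a subgraph isomorphic to. $S_k$ denotes the star on $k$ vertices. $S_n(2,1)$ denotes the tree of order $n$ obtained from the star $S_{n-2}$ by subdividing each of two chosen edges once. $S_n(3)$ denotes the tree of order $n$ obtained from the stars $S_3$ (path on 3 vertices, center the middle vertex) and $S_{n-3}$ by adding an edge joining their centers. -}

module Defs where

open import Data.Nat using (ℕ; zero; suc; _∸_; _≡ᵇ_; _≤ᵇ_)
open import Data.Bool using (Bool; true; false; T; _∧_; _∨_; if_then_else_)
open import Data.Fin using (Fin; toℕ)
open import Data.List using (List; map; allFin)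
open import Data.Nat.ListAction using (sum)
open import Data.Product using (Σ; _×_)
open import Function.Definitions using (Injective)
open import Relation.Binary.PropositionalEquality using (_≡_)

record Graph (n : ℕ) : Set where
  field
    adj : Fin n → Fin n → Bool
open Graph public

record IsSimple {n : ℕ} (G : Graph n) : Set where
  field
    symm   : ∀ i j → adj G i j ≡ adj G j i
    irrefl : ∀ i → adj G i i ≡ false

degree : ∀ {n} → Graph n → Fin n → ℕ
degree {n} G v = sum (map (λ w → if adj G v w then 1 else 0) (allFin n))

Contains : ∀ {n} → Graph n → Graph n → Set
Contains {n} H G =
  Σ (Fin n → Fin n) λ f → Injective _≡_ _≡_ f ×
    (∀ i j → T (adj H i j) → T (adj G (f i) (f j)))

symGraph : ∀ n → (ℕ → ℕ → Bool) → Graph n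
symGraph n e = record { adj = λ i j → e (toℕ i) (toℕ j) ∨ e (toℕ j) (toℕ i) }

-- S_n(2,1): star S_{n-2} with centre 0 and leaves 1..n-3; the edges 0-1 and
-- 0-2 are subdivided by the new vertices n-2 and n-1 respectively.
edgesS21 : ℕ → ℕ → ℕ → Bool
edgesS21 n x y =
  ((x ≡ᵇ 0) ∧ ((1 ≤ᵇ y) ∧ (y ≤ᵇ n ∸ 3)))
  ∨ (((x ≡ᵇ 1) ∧ (y ≡ᵇ n ∸ 2)) ∨ ((x ≡ᵇ 2) ∧ (y ≡ᵇ n ∸ 1)))

S21 : ∀ n → Graph n
S21 n = symGraph n (edgesS21 n)

-- S_n(3): star S_{n-3} with centre 0 and leaves 1..n-4; path S_3 on
-- n-2, n-3, n-1 with centre n-3; plus the edge 0-(n-3) joining the centres.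
edgesS3 : ℕ → ℕ → ℕ → Bool
edgesS3 n x y =
  ((x ≡ᵇ 0) ∧ ((1 ≤ᵇ y) ∧ (y ≤ᵇ n ∸ 3)))
  ∨ ((x ≡ᵇ n ∸ 3) ∧ ((n ∸ 2 ≤ᵇ y) ∧ (y ≤ᵇ n ∸ 1)))

S3 : ∀ n → Graph n
S3 n = symGraph n (edgesS3 n)

-- A vertex v of degree at least n ∸ 3 is adjacent to all vertices except at most two others,
-- x and y. Map the centre of the large star of either tree to v; every vertex not on the short
-- legs is then a leaf at v, so only the legs need care. For S_n(2,1), hang x and y below two
-- further neighbours of v; for S_n(3), hang both below one common neighbour u ≠ v. When x and y
-- really are non-neighbours of v, such a u exists because deg x + deg y ≥ 2n - 8 > n; when v
-- misses at most one vertex x, take u a neighbour of x and then y a further neighbour of u. The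
-- embedding itself extends the few prescribed values to a permutation, one transposition at a time.

module Submission where

open import Defs
open import Data.Nat using (ℕ; zero; suc; _+_; _≤_; _<_; _∸_; z≤n; s≤s; s≤s⁻¹; _<?_)
open import Data.Nat.Properties
  using ( +-suc; +-comm; +-identityʳ; +-cancelˡ-<; +-mono-≤; +-monoʳ-≤; +-monoˡ-<
        ; ≤-reflexive; ≤-trans; ≤-antisym; <-irrefl; <⇒≢; m≤m+n; m≤n+m; m≤n⇒m≤1+n; m≤n⇒m<n∨m≡n
        ; m≤n⇒∃[o]m+o≡n; ≡ᵇ⇒≡; ≤ᵇ⇒≤; module ≤-Reasoning )
open import Data.Fin using (Fin; zero; suc; toℕ; opposite)
open import Data.Fin.Patterns using (0F; 1F; 2F)
open import Data.Fin.Properties using (_≟_; any?; toℕ-injective; opposite-prop; opposite-involutive)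
import Data.Fin.Permutation.Components as PC
open import Data.Bool using (Bool; true; false; T; not; _∧_; if_then_else_)
open import Data.Bool.Properties using (∧-identityʳ; ∧-zeroʳ; T-∧; T-∨)
open import Data.List using (List; []; _∷_; length; map; tabulate)
open import Data.List.Properties using (map-tabulate)
open import Data.Nat.ListAction using (sum)
open import Data.List.Relation.Unary.All as All using (All; []; _∷_)
open import Data.List.Relation.Unary.All.Properties using (¬Any⇒All¬)
open import Data.List.Relation.Unary.Any as Any using (here; there)
open import Data.List.Relation.Unary.Unique.Propositional using (Unique; []; _∷_)
open import Data.List.Membership.Propositional using (_∉_)
open import Data.List.Relation.Binary.Subset.Propositional using (_⊆_)
open import Data.List.Relation.Binary.Subset.Propositional.Properties using (xs⊆xs++ys)
open import Data.Product using (Σ; ∃; _×_; _,_; proj₁; proj₂; <_,_>)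
open import Data.Sum using (_⊎_; inj₁; inj₂; [_,_]′)
open import Data.Empty using (⊥-elim)
open import Function using (_∘_; id)
open import Function.Bundles using (Equivalence)
open import Function.Definitions using (Injective)
open import Relation.Binary.PropositionalEquality
open import Relation.Nullary using (¬_; Dec; yes; no; contradiction)
open import Relation.Nullary.Decidable using (True; toWitness; does; T?; ¬?; _×-dec_; decidable-stable; dec-true; dec-false)

open Equivalence using (to)

count : ∀ {n} → (Fin n → Bool) → ℕ
count {zero}  p = 0
count {suc n} p = (if p zero then 1 else 0) + count (p ∘ suc)

degree≡count : ∀ {n} (G : Graph n) v → degree G v ≡ count (adj G v)
degree≡count {n} G v = trans (cong sum (map-tabulate id (indicator (adj G v)))) (sum-tabulate (adj G v))
  where
  indicator : ∀ {m} → (Fin m → Bool) → Fin m → ℕ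
  indicator p w = if p w then 1 else 0
  sum-tabulate : ∀ {m} (p : Fin m → Bool) → sum (tabulate (indicator p)) ≡ count p
  sum-tabulate {zero}  p = refl
  sum-tabulate {suc m} p = cong (indicator p zero +_) (sum-tabulate (p ∘ suc))

count-cong : ∀ {n} {p q : Fin n → Bool} → (∀ w → p w ≡ q w) → count p ≡ count q
count-cong {zero}  p≗q = refl
count-cong {suc n} p≗q = cong₂ (λ b c → (if b then 1 else 0) + c) (p≗q zero) (count-cong (p≗q ∘ suc))

count-complement : ∀ {n} (p : Fin n → Bool) → count p + count (not ∘ p) ≡ n
count-complement {zero}  p = refl
count-complement {suc n} p with p zero | count-complement (p ∘ suc)
... | true  | eq = cong suc eq
... | false | eq = trans (+-suc _ _) (cong suc eq)

count-∧ : ∀ {n} (p q : Fin n → Bool) → count p + count q ≤ n + count (λ w → p w ∧ q w)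
count-∧ {zero}  p q = z≤n
count-∧ {suc n} p q with p zero | q zero | count-∧ (p ∘ suc) (q ∘ suc)
... | true  | true  | ih = s≤s (subst₂ _≤_ (sym (+-suc _ _)) (sym (+-suc _ _)) (s≤s ih))
... | true  | false | ih = s≤s ih
... | false | true  | ih = ≤-trans (≤-reflexive (+-suc _ _)) (s≤s ih)
... | false | false | ih = m≤n⇒m≤1+n ih

_─_ : ∀ {n} → (Fin n → Bool) → Fin n → Fin n → Bool
(p ─ a) w = p w ∧ not (does (w ≟ a))

count-─ : ∀ {n} (p : Fin n → Bool) a → count p ≡ (if p a then 1 else 0) + count (p ─ a)
count-─ {suc n} p zero with p zero
... | true  = cong suc (count-cong λ w → sym (∧-identityʳ (p (suc w))))
... | false = count-cong λ w → sym (∧-identityʳ (p (suc w)))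
count-─ {suc n} p (suc a) with p zero | count-─ (p ∘ suc) a
... | true  | ih = trans (cong suc ih) (sym (+-suc _ _))
... | false | ih = ih

count≡1+count─ : ∀ {n} (p : Fin n → Bool) a → T (p a) → count p ≡ suc (count (p ─ a))
count≡1+count─ p a pa with p a | count-─ p a
... | true  | eq = eq
... | false | _  = ⊥-elim pa

count≤1+count─ : ∀ {n} (p : Fin n → Bool) a → count p ≤ suc (count (p ─ a))
count≤1+count─ p a with p a | count-─ p a
... | true  | eq = ≤-reflexive eq
... | false | eq = m≤n⇒m≤1+n (≤-reflexive eq)

T-─⁺ : ∀ {n} {p : Fin n → Bool} {a w} → T (p w) → w ≢ a → T ((p ─ a) w)
T-─⁺ {p = p} {a} {w} pw w≢a with w ≟ a
... | yes w≡a = contradiction w≡a w≢a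
... | no  _   = subst T (sym (∧-identityʳ (p w))) pw

T-─⁻ : ∀ {n} {p : Fin n → Bool} {a w} → T ((p ─ a) w) → T (p w) × w ≢ a
T-─⁻ {p = p} {a} {w} t with w ≟ a
... | yes _   = ⊥-elim (subst T (∧-zeroʳ (p w)) t)
... | no  w≢a = subst T (∧-identityʳ (p w)) t , w≢a

count>0⇒∃ : ∀ {n} (p : Fin n → Bool) → 0 < count p → ∃ (T ∘ p)
count>0⇒∃ {suc n} p pos with p zero in pz
... | true  = zero , subst T (sym pz) _
... | false = let w , pw = count>0⇒∃ (p ∘ suc) pos in suc w , pw

length≤count : ∀ {n} {p : Fin n → Bool} {xs} → Unique xs → All (T ∘ p) xs → length xs ≤ count p
length≤count {xs = []}     _            _         = z≤n
length≤count {p = p} {a ∷ xs} (a∉xs ∷ u) (pa ∷ ps) = begin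
  suc (length xs)     ≤⟨ s≤s (length≤count u xs-in-p─a) ⟩
  suc (count (p ─ a)) ≡⟨ count≡1+count─ p a pa ⟨
  count p             ∎
  where
  open ≤-Reasoning
  xs-in-p─a : All (T ∘ (p ─ a)) xs
  xs-in-p─a = All.zipWith (λ (pw , a≢w) → T-─⁺ {p = p} pw (≢-sym a≢w)) (ps , a∉xs)

length<count⇒∃∉ : ∀ {n} (p : Fin n → Bool) xs → length xs < count p → ∃ λ w → T (p w) × w ∉ xs
length<count⇒∃∉ p []       pos = let w , pw = count>0⇒∃ p pos in w , pw , λ ()
length<count⇒∃∉ p (a ∷ xs) lt with length<count⇒∃∉ (p ─ a) xs (s≤s⁻¹ (≤-trans lt (count≤1+count─ p a)))
... | w , t , w∉xs = let pw , w≢a = T-─⁻ {p = p} t in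
  w , pw , λ { (here w≡a) → w≢a w≡a ; (there w∈xs) → w∉xs w∈xs }

Adj : ∀ {n} → Graph n → Fin n → Fin n → Set
Adj G v w = T (adj G v w)

Dominates : ∀ {n} → Graph n → Fin n → List (Fin n) → Set
Dominates G v xs = ∀ {w} → w ∉ xs → Adj G v w

module _ {n} {G : Graph n} (simple : IsSimple G) where

  Adj-sym : ∀ {v w} → Adj G v w → Adj G w v
  Adj-sym {v} {w} = subst T (IsSimple.symm simple v w)

  Adj-irrefl : ∀ {v w} → Adj G v w → v ≢ w
  Adj-irrefl {v} vv refl = subst T (IsSimple.irrefl simple v) vv

neighbour-avoiding : ∀ {n} (G : Graph n) {v} xs → length xs < degree G v → ∃ λ w → Adj G v w × w ∉ xs
neighbour-avoiding G {v} xs lt = length<count⇒∃∉ (adj G v) xs (subst (length xs <_) (degree≡count G v) lt)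

common-neighbour : ∀ {n} (G : Graph n) {x y} → n < degree G x + degree G y → ∃ λ u → Adj G x u × Adj G y u
common-neighbour {n} G {x} {y} n<dx+dy =
  let u , xu∧yu = count>0⇒∃ both (+-cancelˡ-< n 0 (count both) n+0<n+common) in u , to T-∧ xu∧yu
  where
  both : Fin n → Bool
  both w = adj G x w ∧ adj G y w
  n+0<n+common : n + 0 < n + count both
  n+0<n+common = begin-strict
    n + 0                             ≡⟨ +-identityʳ n ⟩
    n                                 <⟨ n<dx+dy ⟩
    degree G x + degree G y           ≡⟨ cong₂ _+_ (degree≡count G x) (degree≡count G y) ⟩
    count (adj G x) + count (adj G y) ≤⟨ count-∧ (adj G x) (adj G y) ⟩
    n + count both                    ∎
    where open ≤-Reasoning

unique-triple : ∀ {A : Set} {v x y : A} → x ≢ v → y ∉ v ∷ x ∷ [] → Unique (v ∷ x ∷ y ∷ [])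
unique-triple x≢v y∉vx = (≢-sym x≢v ∷ ≢-sym (y∉vx ∘ here) ∷ []) ∷ (≢-sym (y∉vx ∘ there ∘ here) ∷ []) ∷ [] ∷ []

dominates-⊆ : ∀ {n} {G : Graph n} {v xs ys} → xs ⊆ ys → Dominates G v xs → Dominates G v ys
dominates-⊆ xs⊆ys dom w∉ys = dom (w∉ys ∘ xs⊆ys)

¬non-neighbour⇒dominates : ∀ {n} (G : Graph n) {v xs} → ¬ (∃ λ w → w ∉ xs × ¬ Adj G v w) → Dominates G v xs
¬non-neighbour⇒dominates G {v} none {w} w∉xs = decidable-stable (T? (adj G v w)) λ v≁w → none (w , w∉xs , v≁w)

non-neighbour? : ∀ {n} (G : Graph n) v xs → Dec (∃ λ w → w ∉ xs × ¬ Adj G v w)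
non-neighbour? G v xs = any? λ w → ¬? (Any.any? (w ≟_) xs) ×-dec ¬? (T? (adj G v w))

¬T⇒T-not : ∀ {b} → ¬ T b → T (not b)
¬T⇒T-not {true}  ¬t = ¬t _
¬T⇒T-not {false} _  = _

dominates-by-degree : ∀ {n} (G : Graph n) {v xs} → Unique xs → All (λ x → ¬ Adj G v x) xs →
                      n ≤ length xs + degree G v → Dominates G v xs
dominates-by-degree {n} G {v} {xs} distinct non-adj n≤ {w} w∉xs =
  decidable-stable (T? (adj G v w)) λ v≁w → <-irrefl refl (n<n v≁w)
  where
  non-neighbours : Fin n → Bool
  non-neighbours = not ∘ adj G v
  n<n : ¬ Adj G v w → n < n
  n<n v≁w = begin-strict
    n                                      ≤⟨ n≤ ⟩
    length xs + degree G v                 <⟨ +-monoˡ-< (degree G v) w∷xs≤non-neighbours ⟩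
    count non-neighbours + degree G v      ≡⟨ +-comm _ (degree G v) ⟩
    degree G v + count non-neighbours      ≡⟨ cong (_+ count non-neighbours) (degree≡count G v) ⟩
    count (adj G v) + count non-neighbours ≡⟨ count-complement (adj G v) ⟩
    n                                      ∎
    where
    open ≤-Reasoning
    w∷xs≤non-neighbours : suc (length xs) ≤ count non-neighbours
    w∷xs≤non-neighbours =
      length≤count (¬Any⇒All¬ xs w∉xs ∷ distinct) (¬T⇒T-not v≁w ∷ All.map ¬T⇒T-not non-adj)

transpose-injective : ∀ {n} (i j : Fin n) → Injective _≡_ _≡_ (PC.transpose i j)
transpose-injective i j {x} {y} e = begin
  x                                       ≡⟨ PC.transpose-inverse j i ⟨
  PC.transpose j i (PC.transpose i j x)   ≡⟨ cong (PC.transpose j i) e ⟩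
  PC.transpose j i (PC.transpose i j y)   ≡⟨ PC.transpose-inverse j i ⟩
  y                                       ∎
  where open ≡-Reasoning

transpose-second : ∀ {n} (i j : Fin n) → PC.transpose i j j ≡ i
transpose-second i j with j ≟ i
... | yes refl = refl
... | no  _    rewrite dec-true (j ≟ j) refl = refl

transpose-fixes : ∀ {n} {i j k : Fin n} → k ≢ i → k ≢ j → PC.transpose i j k ≡ k
transpose-fixes {i = i} {j} {k} k≢i k≢j rewrite dec-false (k ≟ i) k≢i | dec-false (k ≟ j) k≢j = refl

extend-injection : ∀ {n} (ps : List (Fin n × Fin n)) → Unique (map proj₁ ps) → Unique (map proj₂ ps) →
                   ∃ λ (f : Fin n → Fin n) → Injective _≡_ _≡_ f × All (λ (s , t) → f s ≡ t) ps
extend-injection []             _            _            = id , id , []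
extend-injection ((s , t) ∷ ps) (s∉ ∷ ss-unique) (t∉ ∷ ts-unique) with extend-injection ps ss-unique ts-unique
... | f , f-inj , f-ps = PC.transpose t (f s) ∘ f
                       , f-inj ∘ transpose-injective t (f s)
                       , transpose-second t (f s) ∷ kept ps s∉ t∉ f-ps
  where
  kept : ∀ qs → All (s ≢_) (map proj₁ qs) → All (t ≢_) (map proj₂ qs) →
         All (λ (s′ , t′) → f s′ ≡ t′) qs →
          All (λ (s′ , t′) → PC.transpose t (f s) (f s′) ≡ t′) qs
  kept []                []           []           []             = []
  kept ((s′ , t′) ∷ qs) (s≢s′ ∷ s∉) (t≢t′ ∷ t∉) (fs′≡t′ ∷ f-qs) =
    trans (cong (PC.transpose t (f s)) fs′≡t′)
          (transpose-fixes (≢-sym t≢t′) λ t′≡fs → s≢s′ (f-inj (trans (sym t′≡fs) (sym fs′≡t′))))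
    ∷ kept qs s∉ t∉ f-qs

symGraph⊆ : ∀ {n} {G : Graph n} → IsSimple G → ∀ {e} (f : Fin n → Fin n) → Injective _≡_ _≡_ f →
            (∀ i j → T (e (toℕ i) (toℕ j)) → Adj G (f i) (f j)) → Contains (symGraph n e) G
symGraph⊆ simple f f-inj edge = f , f-inj , λ i j → [ edge i j , Adj-sym simple ∘ edge j i ]′ ∘ to T-∨

Adj-along : ∀ {n} {G : Graph n} (f : Fin n → Fin n) {i j s t x y} →
            i ≡ s → j ≡ t → f s ≡ x → f t ≡ y → Adj G x y → Adj G (f i) (f j)
Adj-along f refl refl refl refl xy = xy

opposite-injective : ∀ {n} → Injective _≡_ _≡_ (opposite {n})
opposite-injective {x = i} {j} e = begin
  i                     ≡⟨ opposite-involutive i ⟨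
  opposite (opposite i) ≡⟨ cong opposite e ⟩
  opposite (opposite j) ≡⟨ opposite-involutive j ⟩
  j                     ∎
  where open ≡-Reasoning

opposite-≢ : ∀ {n} (i j : Fin n) → i ≢ j → opposite i ≢ opposite j
opposite-≢ i j i≢j = i≢j ∘ opposite-injective

≢opposite : ∀ {n} {i : Fin n} j → toℕ i ≢ n ∸ suc (toℕ j) → i ≢ opposite j
≢opposite j ne e = ne (trans (cong toℕ e) (opposite-prop j))

≡opposite : ∀ {n} {i : Fin n} j → toℕ i ≡ n ∸ suc (toℕ j) → i ≡ opposite j
≡opposite j e = toℕ-injective (trans e (sym (opposite-prop j)))

m≤n≤1+m⇒n≡m⊎n≡1+m : ∀ {m n} → m ≤ n → n ≤ suc m → n ≡ m ⊎ n ≡ suc m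
m≤n≤1+m⇒n≡m⊎n≡1+m m≤n n≤1+m with m≤n⇒m<n∨m≡n n≤1+m
... | inj₁ n<1+m = inj₁ (≤-antisym (s≤s⁻¹ n<1+m) m≤n)
... | inj₂ n≡1+m = inj₂ n≡1+m

S3-edge : ∀ m x y → T (edgesS3 (4 + m) x y) →
          (x ≡ 0 × 1 ≤ y × y ≤ suc m) ⊎ (x ≡ suc m × (y ≡ 2 + m ⊎ y ≡ 3 + m))
S3-edge m x y t with to T-∨ t
... | inj₁ star = let x≡0 , range = to T-∧ star ; lo , hi = to T-∧ range in
  inj₁ (≡ᵇ⇒≡ x 0 x≡0 , ≤ᵇ⇒≤ 1 y lo , ≤ᵇ⇒≤ y _ hi)
... | inj₂ path = let x≡ , range = to T-∧ path ; lo , hi = to T-∧ range in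
  inj₂ (≡ᵇ⇒≡ x _ x≡ , m≤n≤1+m⇒n≡m⊎n≡1+m (≤ᵇ⇒≤ _ y lo) (≤ᵇ⇒≤ y _ hi))

S21-edge : ∀ m x y → T (edgesS21 (5 + m) x y) →
           (x ≡ 0 × 1 ≤ y × y ≤ 2 + m) ⊎ (x ≡ 1 × y ≡ 3 + m) ⊎ (x ≡ 2 × y ≡ 4 + m)
S21-edge m x y t with to T-∨ t
... | inj₁ star = let x≡0 , range = to T-∧ star ; lo , hi = to T-∧ range in
  inj₁ (≡ᵇ⇒≡ x 0 x≡0 , ≤ᵇ⇒≤ 1 y lo , ≤ᵇ⇒≤ y _ hi)
... | inj₂ legs with to T-∨ legs
...   | inj₁ leg₁ = let x≡1 , y≡ = to T-∧ leg₁ in inj₂ (inj₁ (≡ᵇ⇒≡ x 1 x≡1 , ≡ᵇ⇒≡ y _ y≡))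
...   | inj₂ leg₂ = let x≡2 , y≡ = to T-∧ leg₂ in inj₂ (inj₂ (≡ᵇ⇒≡ x 2 x≡2 , ≡ᵇ⇒≡ y _ y≡))

-- The labels n ∸ 1, n ∸ 2 and n ∸ 3 of Defs are opposite 0F, opposite 1F and opposite 2F.
spoke : ∀ {m} {G : Graph (3 + m)} {f : Fin (3 + m) → Fin (3 + m)} → Injective _≡_ _≡_ f → ∀ {v a b} →
        f 0F ≡ v → f (opposite 1F) ≡ a → f (opposite 0F) ≡ b → Dominates G v (v ∷ a ∷ b ∷ []) →
        ∀ j → 1 ≤ toℕ j → toℕ j ≤ m → Adj G v (f j)
spoke {m} f-inj refl refl refl dom j 1≤j j≤m = dom λ
  { (here fj≡)                 → <⇒≢ 1≤j (sym (cong toℕ (f-inj fj≡)))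
  ; (there (here fj≡))         → ≢opposite 1F (<⇒≢ (s≤s j≤m)) (f-inj fj≡)
  ; (there (there (here fj≡))) → ≢opposite 0F (<⇒≢ (s≤s (m≤n⇒m≤1+n j≤m))) (f-inj fj≡)
  }

S3-labels-distinct : ∀ {m} → Unique {A = Fin (4 + m)}
                       (0F ∷ opposite 2F ∷ opposite 1F ∷ opposite 0F ∷ [])
S3-labels-distinct = (≢opposite 2F (λ ()) ∷ ≢opposite 1F (λ ()) ∷ ≢opposite 0F (λ ()) ∷ [])
                   ∷ (opposite-≢ 2F 1F (λ ()) ∷ opposite-≢ 2F 0F (λ ()) ∷ [])
                   ∷ (opposite-≢ 1F 0F (λ ()) ∷ []) ∷ [] ∷ []

S3⊆ : ∀ {m} {G : Graph (4 + m)} → IsSimple G → ∀ {v u a b} → Unique (v ∷ u ∷ a ∷ b ∷ []) →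
      Dominates G v (v ∷ a ∷ b ∷ []) → Adj G u a → Adj G u b → Contains (S3 (4 + m)) G
S3⊆ {m} {G} simple {v} {u} {a} {b} distinct dom ua ub
  with extend-injection ((0F , v) ∷ (opposite 2F , u) ∷ (opposite 1F , a) ∷ (opposite 0F , b) ∷ [])
                        S3-labels-distinct distinct
... | f , f-inj , f0 ∷ fu ∷ fa ∷ fb ∷ [] = symGraph⊆ simple {edgesS3 (4 + m)} f f-inj edge
  where
  edge : ∀ i j → T (edgesS3 (4 + m) (toℕ i) (toℕ j)) → Adj G (f i) (f j)
  edge i j e with S3-edge m (toℕ i) (toℕ j) e
  ... | inj₁ (i≡0 , 1≤j , j≤) =
    Adj-along {G = G} f (toℕ-injective i≡0) refl f0 refl (spoke {G = G} f-inj f0 fa fb dom j 1≤j j≤)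
  ... | inj₂ (i≡ , inj₁ j≡)   = Adj-along {G = G} f (≡opposite 2F i≡) (≡opposite 1F j≡) fu fa ua
  ... | inj₂ (i≡ , inj₂ j≡)   = Adj-along {G = G} f (≡opposite 2F i≡) (≡opposite 0F j≡) fu fb ub

S21-labels-distinct : ∀ {m} → Unique {A = Fin (5 + m)} (0F ∷ 1F ∷ 2F ∷ opposite 1F ∷ opposite 0F ∷ [])
S21-labels-distinct = ((λ ()) ∷ (λ ()) ∷ ≢opposite 1F (λ ()) ∷ ≢opposite 0F (λ ()) ∷ [])
                    ∷ ((λ ()) ∷ ≢opposite 1F (λ ()) ∷ ≢opposite 0F (λ ()) ∷ [])
                    ∷ (≢opposite 1F (λ ()) ∷ ≢opposite 0F (λ ()) ∷ [])
                    ∷ (opposite-≢ 1F 0F (λ ()) ∷ []) ∷ [] ∷ []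

S21⊆ : ∀ {m} {G : Graph (5 + m)} → IsSimple G → ∀ {v p q a b} → Unique (v ∷ p ∷ q ∷ a ∷ b ∷ []) →
       Dominates G v (v ∷ a ∷ b ∷ []) → Adj G p a → Adj G q b → Contains (S21 (5 + m)) G
S21⊆ {m} {G} simple {v} {p} {q} {a} {b} distinct dom pa qb
  with extend-injection ((0F , v) ∷ (1F , p) ∷ (2F , q) ∷ (opposite 1F , a) ∷ (opposite 0F , b) ∷ [])
                        S21-labels-distinct distinct
... | f , f-inj , f0 ∷ fp ∷ fq ∷ fa ∷ fb ∷ [] = symGraph⊆ simple {edgesS21 (5 + m)} f f-inj edge
  where
  edge : ∀ i j → T (edgesS21 (5 + m) (toℕ i) (toℕ j)) → Adj G (f i) (f j)
  edge i j e with S21-edge m (toℕ i) (toℕ j) e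
  ... | inj₁ (i≡0 , 1≤j , j≤)  =
    Adj-along {G = G} f (toℕ-injective i≡0) refl f0 refl (spoke {G = G} f-inj f0 fa fb dom j 1≤j j≤)
  ... | inj₂ (inj₁ (i≡1 , j≡)) = Adj-along {G = G} f (toℕ-injective i≡1) (≡opposite 1F j≡) fp fa pa
  ... | inj₂ (inj₂ (i≡2 , j≡)) = Adj-along {G = G} f (toℕ-injective i≡2) (≡opposite 0F j≡) fq fb qb

module _ {k} {G : Graph (9 + k)} (simple : IsSimple G) (δ : ∀ w → 5 + k ≤ degree G w) where

  record AlmostUniversal (v : Fin (9 + k)) : Set where
    field
      {x y u}   : Fin (9 + k)
      distinct  : Unique (v ∷ x ∷ y ∷ [])
      dominates : Dominates G v (v ∷ x ∷ y ∷ [])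
      x∼u       : Adj G x u
      y∼u       : Adj G y u
      u≢v       : u ≢ v

  fresh-neighbour : ∀ w xs {short : True (length xs <? 5)} → ∃ λ u → Adj G w u × u ∉ xs
  fresh-neighbour w xs {short} = neighbour-avoiding G xs (≤-trans (toWitness short) (≤-trans (m≤m+n 5 k) (δ w)))

  almostUniversal-from-pair : ∀ {v x} → x ≢ v → Dominates G v (v ∷ x ∷ []) → AlmostUniversal v
  almostUniversal-from-pair {v} {x} x≢v dom
    with fresh-neighbour x (v ∷ [])
  ... | u , x∼u , u∉v with fresh-neighbour u (v ∷ x ∷ [])
  ... | y , u∼y , y∉vx = record
    { distinct  = unique-triple x≢v y∉vx
    ; dominates = dominates-⊆ {G = G} (xs⊆xs++ys (v ∷ x ∷ []) (y ∷ [])) dom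
    ; x∼u       = x∼u
    ; y∼u       = Adj-sym simple u∼y
    ; u≢v       = u∉v ∘ here
    }

  almostUniversal-from-non-neighbours : ∀ {v x y} → 6 + k ≤ degree G v → x ≢ v → ¬ Adj G v x →
                                        y ∉ v ∷ x ∷ [] → ¬ Adj G v y → AlmostUniversal v
  almostUniversal-from-non-neighbours {v} {x} {y} Δv x≢v v≁x y∉vx v≁y
    with common-neighbour G {x} {y} (≤-trans (+-monoʳ-≤ 5 (m≤n+m (5 + k) k)) (+-mono-≤ (δ x) (δ y)))
  ... | u , x∼u , y∼u = record
    { distinct  = unique-triple x≢v y∉vx
    ; dominates = dominates-by-degree G (unique-triple x≢v y∉vx)
                    ((λ v∼v → Adj-irrefl simple v∼v refl) ∷ v≁x ∷ v≁y ∷ []) (+-monoʳ-≤ 3 Δv)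
    ; x∼u       = x∼u
    ; y∼u       = y∼u
    ; u≢v       = λ { refl → v≁x (Adj-sym simple x∼u) }
    }

  almostUniversal : ∀ v → 6 + k ≤ degree G v → AlmostUniversal v
  almostUniversal v Δv with non-neighbour? G v (v ∷ [])
  ... | no none = let x , v∼x , _ = fresh-neighbour v [] in
    almostUniversal-from-pair (≢-sym (Adj-irrefl simple v∼x))
      (dominates-⊆ {G = G} (xs⊆xs++ys (v ∷ []) (x ∷ [])) (¬non-neighbour⇒dominates G none))
  ... | yes (x , x∉v , v≁x) with non-neighbour? G v (v ∷ x ∷ [])
  ...   | no none                = almostUniversal-from-pair (x∉v ∘ here) (¬non-neighbour⇒dominates G none)
  ...   | yes (y , y∉vx , v≁y)  = almostUniversal-from-non-neighbours Δv (x∉v ∘ here) v≁x y∉vx v≁y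

  almostUniversal⇒S3⊆ : ∀ {v} → AlmostUniversal v → Contains (S3 (9 + k)) G
  almostUniversal⇒S3⊆ {v} record { x = x ; y = y ; u = u ; dominates = dom ; x∼u = x∼u ; y∼u = y∼u ; u≢v = u≢v
                         ; distinct = (v≢x ∷ v≢y ∷ []) ∷ (x≢y ∷ []) ∷ [] ∷ [] } =
    S3⊆ simple targets-distinct dom (Adj-sym simple x∼u) (Adj-sym simple y∼u)
    where
    targets-distinct : Unique (v ∷ u ∷ x ∷ y ∷ [])
    targets-distinct = (≢-sym u≢v ∷ v≢x ∷ v≢y ∷ [])
                     ∷ (≢-sym (Adj-irrefl simple x∼u) ∷ ≢-sym (Adj-irrefl simple y∼u) ∷ [])
                     ∷ (x≢y ∷ []) ∷ [] ∷ []

  almostUniversal⇒S21⊆ : ∀ {v} → AlmostUniversal v → Contains (S21 (9 + k)) G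
  almostUniversal⇒S21⊆ {v} record { x = x ; y = y ; dominates = dom
                                   ; distinct = (v≢x ∷ v≢y ∷ []) ∷ (x≢y ∷ []) ∷ [] ∷ [] }
    with fresh-neighbour x (v ∷ y ∷ [])
  ... | p , x∼p , p∉vy with fresh-neighbour y (v ∷ x ∷ p ∷ [])
  ... | q , y∼q , q∉vxp = S21⊆ simple targets-distinct dom (Adj-sym simple x∼p) (Adj-sym simple y∼q)
    where
    targets-distinct : Unique (v ∷ p ∷ q ∷ x ∷ y ∷ [])
    targets-distinct = (≢-sym (p∉vy ∘ here) ∷ ≢-sym (q∉vxp ∘ here) ∷ v≢x ∷ v≢y ∷ [])
                     ∷ ( ≢-sym (q∉vxp ∘ there ∘ there ∘ here) ∷ ≢-sym (Adj-irrefl simple x∼p)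
                       ∷ p∉vy ∘ there ∘ here ∷ [])
                     ∷ (q∉vxp ∘ there ∘ here ∷ ≢-sym (Adj-irrefl simple y∼q) ∷ [])
                     ∷ (x≢y ∷ []) ∷ [] ∷ []

lemma3 : ∀ (n : ℕ) (G : Graph n) → IsSimple G → 9 ≤ n
         → (∀ v → n ∸ 4 ≤ degree G v)
         → Σ (Fin n) (λ v → n ∸ 3 ≤ degree G v)
         → Contains (S3 n) G × Contains (S21 n) G
lemma3 n G simple 9≤n δ (v , Δv) with m≤n⇒∃[o]m+o≡n 9≤n
... | k , refl = < almostUniversal⇒S3⊆ simple δ , almostUniversal⇒S21⊆ simple δ > (almostUniversal simple δ v Δv)
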